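{- Let $x>0$ be real. The set $\mathrm{Tame}_x$, with games identified up to the equivalence $=_x$, is a group under the disjunctive sum $+_{\ell}$.
   Context: A (short) scoring play game is $G=\{G^L\mid G^S\mid G^R\}$, where $G^L,G^R$ are finite sets of scoring play games (Left and Right options) and $G^S\in\mathbb{R}$ is the score; recursive, with base case $G^L=G^R=\emptyset$. Write $a$ for $\{\cdot\mid a\mid\cdot\}$. Disjunctive sum: $G+_{\ell}H=\{G^L+_{\ell}H,\ G+_{\ell}H^L\mid G^S+H^S\mid G^R+_{\ell}H,\ G+_{\ell}H^R\}$. For $c\in\mathbb{R}$, $G+_{\ell}c=G+_{\ell}\{\cdot\mid c\mid\cdot\}$. Negative: $-G=\{ -G^R\mid -G^S\mid -G^L\}$. Final scores: $G_F^{SL}=G^S$ if $G^L=\emptyset$, else $\max_{G'\in G^L}G'^{SR}_F$; $G_F^{SR}=G^S$ if $G^R=\emptyset$, else $\min_{G'\in G^R}G'^{SL}_F$. $L_>,L_<,L_=$ (resp. $R_>,R_<,R_=$) are the games with $G_F^{SL}$ (resp. $G_F^{SR}$) $>0,<0,=0$. Outcome classes: $\mathcal{L}=(L_>\cap R_>)\cup(L_>\cap R_=)\cup(L_=\cap R_>)$, $\mathcal{R}=(L_<\cap R_<)\cup(L_<\cap R_=)\cup(L_=\cap R_<)$, $\mathcal{N}=L_>\cap R_<$, $\mathcal{P}=L_<\cap R_>$, $\mathcal{T}=L_=\cap R_=$; $G\approx H$ means $G,H$ lie in the same outcome class. $\mathrm{Tame}_x$: $G\in\mathrm{Tame}_x$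 iff $G^S=0$, every Left option is $A+_{\ell}x$ with $A\in\mathrm{Tame}_x$ and every Right option is $B+_{\ell}(-x)$ with $B\in\mathrm{Tame}_x$ (recursively). For $G,H\in\mathrm{Tame}_x$, $G=_xH$ means $G+_{\ell}X\approx H+_{\ell}X$ for all $X\in\mathrm{Tame}_x$. -}

module Defs where

open import Level using (0ℓ)
open import Data.List using (List; []; _∷_; _++_)
open import Data.List.Relation.Unary.All using (All)
open import Data.Product using (Σ; ∃; _×_; _,_; proj₁; proj₂)
open import Data.Sum using (_⊎_)
open import Data.Empty using (⊥)
open import Relation.Nullary using (¬_)
open import Relation.Binary using (Tri; tri<; tri≈; tri>)
open import Relation.Binary.Structures using (IsStrictTotalOrder)
open import Relation.Binary.PropositionalEquality using (_≡_; _≢_)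
open import Algebra.Structures using (IsCommutativeRing; IsGroup)
open import Function.Bundles using (_⇔_)

-- The real numbers, axiomatised as a (Dedekind-)complete ordered field.
-- Any two such structures are isomorphic, so quantifying over all of
-- them is the same as speaking about ℝ.

record RealNumbers : Set₁ where
  infixl 6 _+_
  infixl 7 _*_
  infix 8 -_
  infix 4 _<_ _≤_
  field
    ℝ   : Set
    _+_ _*_ : ℝ → ℝ → ℝ
    -_  : ℝ → ℝ
    0r 1r : ℝ
    _<_ : ℝ → ℝ → Set
    isCommutativeRing : IsCommutativeRing _≡_ _+_ _*_ -_ 0r 1r
    0≢1 : 0r ≢ 1r
    *-inverse : ∀ a → a ≢ 0r → ∃ λ b → a * b ≡ 1r
    isStrictTotalOrder : IsStrictTotalOrder _≡_ _<_
    +-mono-< : ∀ {a b} c → a < b → a + c < b + c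
    *-pos : ∀ {a b} → 0r < a → 0r < b → 0r < a * b

  _≤_ : ℝ → ℝ → Set
  a ≤ b = a < b ⊎ a ≡ b

  field
    complete : (P : ℝ → Set) → ∃ P → (∃ λ u → ∀ a → P a → a ≤ u) →
               ∃ λ s → (∀ a → P a → a ≤ s) ×
                       (∀ u → (∀ a → P a → a ≤ u) → s ≤ u)

module Games (R : RealNumbers) where
  open RealNumbers R

  max min : ℝ → ℝ → ℝ
  max a b with IsStrictTotalOrder.compare isStrictTotalOrder a b
  ... | tri< _ _ _ = b
  ... | tri≈ _ _ _ = a
  ... | tri> _ _ _ = a
  min a b with IsStrictTotalOrder.compare isStrictTotalOrder a b
  ... | tri< _ _ _ = a
  ... | tri≈ _ _ _ = a
  ... | tri> _ _ _ = b

  -- A short scoring play game {G^L | G^S | G^R}; finite option sets as lists.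
  data Game : Set where
    mk : List Game → ℝ → List Game → Game

  num : ℝ → Game
  num a = mk [] a []

  infixl 6 _⊕_
  mutual
    _⊕_ : Game → Game → Game
    g@(mk gl s gr) ⊕ h@(mk hl t hr) =
      mk (lmap gl h ++ rmap g hl) (s + t) (lmap gr h ++ rmap g hr)

    lmap : List Game → Game → List Game
    lmap [] h = []
    lmap (g ∷ gs) h = (g ⊕ h) ∷ lmap gs h

    rmap : Game → List Game → List Game
    rmap g [] = []
    rmap g (h ∷ hs) = (g ⊕ h) ∷ rmap g hs

  mutual
    neg : Game → Game
    neg (mk gl s gr) = mk (negs gr) (- s) (negs gl)

    negs : List Game → List Game
    negs [] = []
    negs (g ∷ gs) = neg g ∷ negs gs

  mutual
    finalL : Game → ℝ
    finalL (mk [] s _) = s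
    finalL (mk (g ∷ gs) _ _) = maxR g gs

    finalR : Game → ℝ
    finalR (mk _ s []) = s
    finalR (mk _ _ (g ∷ gs)) = minL g gs

    maxR : Game → List Game → ℝ
    maxR g [] = finalR g
    maxR g (g' ∷ gs) = max (finalR g) (maxR g' gs)

    minL : Game → List Game → ℝ
    minL g [] = finalL g
    minL g (g' ∷ gs) = min (finalL g) (minL g' gs)

  data Outcome : Set where
    𝓛 𝓡 𝓝 𝓟 𝓣 : Outcome

  L> L< L= R> R< R= : Game → Set
  L> G = 0r < finalL G
  L< G = finalL G < 0r
  L= G = finalL G ≡ 0r
  R> G = 0r < finalR G
  R< G = finalR G < 0r
  R= G = finalR G ≡ 0r

  In : Outcome → Game → Set
  In 𝓛 G = (L> G × R> G) ⊎ (L> G × R= G) ⊎ (L= G × R> G)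
  In 𝓡 G = (L< G × R< G) ⊎ (L< G × R= G) ⊎ (L= G × R< G)
  In 𝓝 G = L> G × R< G
  In 𝓟 G = L< G × R> G
  In 𝓣 G = L= G × R= G

  _≈_ : Game → Game → Set
  G ≈ H = ∀ o → In o G ⇔ In o H

  data Tame (x : ℝ) : Game → Set where
    tame : ∀ {gl gr} →
           All (λ g → Σ Game λ A → Tame x A × g ≡ A ⊕ num x) gl →
           All (λ g → Σ Game λ B → Tame x B × g ≡ B ⊕ num (- x)) gr →
           Tame x (mk gl 0r gr)

  TameGame : ℝ → Set
  TameGame x = Σ Game (Tame x)

  _=[_]_ : Game → ℝ → Game → Set
  G =[ x ] H = ∀ X → Tame x X → (G ⊕ X) ≈ (H ⊕ X)

  -- "Tame_x modulo =_x is a group under +_ℓ": +_ℓ is closed on Tame_x, and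
  -- with equality =_x there is an identity and an inverse map making it a group
  -- (IsGroup includes that =_x is an equivalence and +_ℓ respects it).
  TameIsGroup : ℝ → Set
  TameIsGroup x =
    Σ (∀ {G H} → Tame x G → Tame x H → Tame x (G ⊕ H)) λ closed →
    Σ (TameGame x) λ e →
    Σ (TameGame x → TameGame x) λ inv →
      IsGroup {A = TameGame x}
        (λ a b → proj₁ a =[ x ] proj₁ b)
        (λ a b → (proj₁ a ⊕ proj₁ b) , closed (proj₂ a) (proj₂ b))
        e inv

TameGroupStatement : RealNumbers → Set
TameGroupStatement R = (x : ℝ) → 0r < x → TameIsGroup x
  where open RealNumbers R
        open Games R

-- In a tame game every Left move adds x and every Right move subtracts x, and
-- the players alternate, so a play started by Left ends with score x if Left
-- made the last move and 0 otherwise.  Left maximising and Right minimising the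
-- score are therefore both just trying to move last: G_F^{SL} is x or 0
-- according as Left, moving first, wins G under the normal play convention,
-- and dually G_F^{SR} is −x or 0.  Hence on Tame_x the outcome class is the
-- normal-play outcome, =_x is normal-play equivalence in tame contexts, and the
-- group laws are those of normal play: +_ℓ is associative with identity {·|0|·}
-- on the nose, and G + (−G) is a second-player win by the mirror strategy, so
-- it is absorbed by every sum.

module Submission where

open import Defs
open import Data.Bool using (Bool; true; false; not; _∨_; if_then_else_)
open import Data.Bool.Properties using (∨-assoc; ∨-comm; ∨-identityʳ)
open import Data.Empty using (⊥-elim)
open import Data.List using (List; []; _∷_; _++_)
open import Data.List.Properties using (++-assoc; ++-identityʳ)
open import Data.List.Relation.Unary.All using (All; []; _∷_)
import Data.List.Relation.Unary.All as All
import Data.List.Relation.Unary.All.Properties as Allₚ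
open import Data.List.Relation.Unary.Any using (Any; here; there)
import Data.List.Relation.Unary.Any.Properties as Anyₚ
open import Data.List.Membership.Propositional using (_∈_; lose)
open import Data.List.Membership.Propositional.Properties using (∈-++⁺ˡ; ∈-++⁺ʳ)
open import Data.Product using (Σ; _×_; _,_; proj₁; proj₂)
open import Data.Sum using (_⊎_; inj₁; inj₂)
open import Function using (id; _∘_)
open import Function.Bundles using (_⇔_; Equivalence)
import Function.Properties.Equivalence as ⇔
open import Relation.Nullary using (¬_)
open import Relation.Binary using (tri<; tri≈; tri>; _Preserves_⟶_; Setoid; IsEquivalence)
open import Relation.Binary.Structures using (IsStrictTotalOrder)
open import Relation.Binary.PropositionalEquality
  using (_≡_; refl; sym; trans; cong; cong₂; subst; subst₂; module ≡-Reasoning)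
import Relation.Binary.Reasoning.Setoid as SetoidReasoning
open import Algebra.Structures using (IsCommutativeRing; IsMonoid)
open import Algebra.Bundles using (AbelianGroup)
import Algebra.Properties.AbelianGroup as AbelianGroupProperties

module _ (R : RealNumbers) where
  open RealNumbers R
  open Games R
  open IsCommutativeRing isCommutativeRing
    using (+-assoc; +-comm; +-identityˡ; +-identityʳ; -‿inverseˡ; -‿inverseʳ; +-isAbelianGroup)
  open IsStrictTotalOrder isStrictTotalOrder using (compare)
    renaming (irrefl to <-irrefl; asym to <-asym)

  +-abelianGroup : AbelianGroup _ _
  +-abelianGroup = record { isAbelianGroup = +-isAbelianGroup }

  open AbelianGroupProperties +-abelianGroup using (⁻¹-∙-comm; ε⁻¹≈ε; ⁻¹-involutive)

  -- Ordered-field facts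

  neg-<0 : ∀ {a} → 0r < a → - a < 0r
  neg-<0 {a} 0<a = subst₂ _<_ (+-identityˡ (- a)) (-‿inverseʳ a) (+-mono-< (- a) 0<a)

  ≤⇒≯ : ∀ {a b} → a ≤ b → ¬ b < a
  ≤⇒≯ (inj₁ a<b) b<a = <-asym a<b b<a
  ≤⇒≯ (inj₂ refl) a<a = <-irrefl refl a<a

  max-≡ʳ : ∀ {a b} → a ≤ b → max a b ≡ b
  max-≡ʳ {a} {b} a≤b with compare a b
  ... | tri< _ _ _   = refl
  ... | tri≈ _ a≡b _ = a≡b
  ... | tri> _ _ b<a = ⊥-elim (≤⇒≯ a≤b b<a)

  max-≡ˡ : ∀ {a b} → b ≤ a → max a b ≡ a
  max-≡ˡ {a} {b} b≤a with compare a b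
  ... | tri< a<b _ _ = ⊥-elim (≤⇒≯ b≤a a<b)
  ... | tri≈ _ _ _   = refl
  ... | tri> _ _ _   = refl

  min-≡ˡ : ∀ {a b} → a ≤ b → min a b ≡ a
  min-≡ˡ {a} {b} a≤b with compare a b
  ... | tri< _ _ _   = refl
  ... | tri≈ _ _ _   = refl
  ... | tri> _ _ b<a = ⊥-elim (≤⇒≯ a≤b b<a)

  min-≡ʳ : ∀ {a b} → b ≤ a → min a b ≡ b
  min-≡ʳ {a} {b} b≤a with compare a b
  ... | tri< a<b _ _ = ⊥-elim (≤⇒≯ b≤a a<b)
  ... | tri≈ _ a≡b _ = a≡b
  ... | tri> _ _ _   = refl

  mono-<-distrib-max : ∀ {f} → f Preserves _<_ ⟶ _<_ → ∀ a b → f (max a b) ≡ max (f a) (f b)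
  mono-<-distrib-max {f} mono a b with compare a b | compare (f a) (f b)
  ... | tri< _ _ _   | tri< _ _ _     = refl
  ... | tri< _ _ _   | tri≈ _ fa≡fb _ = sym fa≡fb
  ... | tri< a<b _ _ | tri> _ _ fb<fa = ⊥-elim (<-asym (mono a<b) fb<fa)
  ... | tri≈ _ a≡b _ | tri< _ _ _     = cong f a≡b
  ... | tri≈ _ _ _   | tri≈ _ _ _     = refl
  ... | tri≈ _ _ _   | tri> _ _ _     = refl
  ... | tri> _ _ b<a | tri< fa<fb _ _ = ⊥-elim (<-asym (mono b<a) fa<fb)
  ... | tri> _ _ _   | tri≈ _ _ _     = refl
  ... | tri> _ _ _   | tri> _ _ _     = refl

  mono-<-distrib-min : ∀ {f} → f Preserves _<_ ⟶ _<_ → ∀ a b → f (min a b) ≡ min (f a) (f b)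
  mono-<-distrib-min {f} mono a b with compare a b | compare (f a) (f b)
  ... | tri< _ _ _   | tri< _ _ _     = refl
  ... | tri< _ _ _   | tri≈ _ _ _     = refl
  ... | tri< a<b _ _ | tri> _ _ fb<fa = ⊥-elim (<-asym (mono a<b) fb<fa)
  ... | tri≈ _ _ _   | tri< _ _ _     = refl
  ... | tri≈ _ _ _   | tri≈ _ _ _     = refl
  ... | tri≈ _ a≡b _ | tri> _ _ _     = cong f a≡b
  ... | tri> _ _ b<a | tri< fa<fb _ _ = ⊥-elim (<-asym (mono b<a) fa<fb)
  ... | tri> _ _ _   | tri≈ _ fa≡fb _ = sym fa≡fb
  ... | tri> _ _ _   | tri> _ _ _     = refl

  -- The disjunctive sum

  mk-cong : ∀ {l l′ s s′ r r′} → l ≡ l′ → s ≡ s′ → r ≡ r′ → mk l s r ≡ mk l′ s′ r′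
  mk-cong refl refl refl = refl

  lmap-++ : ∀ gs gs′ H → lmap (gs ++ gs′) H ≡ lmap gs H ++ lmap gs′ H
  lmap-++ []       gs′ H = refl
  lmap-++ (g ∷ gs) gs′ H = cong (g ⊕ H ∷_) (lmap-++ gs gs′ H)

  rmap-++ : ∀ G hs hs′ → rmap G (hs ++ hs′) ≡ rmap G hs ++ rmap G hs′
  rmap-++ G []       hs′ = refl
  rmap-++ G (h ∷ hs) hs′ = cong (G ⊕ h ∷_) (rmap-++ G hs hs′)

  negs-++ : ∀ gs gs′ → negs (gs ++ gs′) ≡ negs gs ++ negs gs′
  negs-++ []       gs′ = refl
  negs-++ (g ∷ gs) gs′ = cong (neg g ∷_) (negs-++ gs gs′)

  mutual
    ⊕-assoc : ∀ G H K → (G ⊕ H) ⊕ K ≡ G ⊕ (H ⊕ K)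
    ⊕-assoc G@(mk gl s gr) H@(mk hl t hr) K@(mk kl u kr) =
      mk-cong (options-assoc G H K gl hl kl) (+-assoc s t u) (options-assoc G H K gr hr kr)

    options-assoc : ∀ G H K gs hs ks →
      lmap (lmap gs H ++ rmap G hs) K ++ rmap (G ⊕ H) ks ≡ lmap gs (H ⊕ K) ++ rmap G (lmap hs K ++ rmap H ks)
    options-assoc G H K gs hs ks = begin
      lmap (lmap gs H ++ rmap G hs) K ++ rmap (G ⊕ H) ks
        ≡⟨ cong (_++ rmap (G ⊕ H) ks) (lmap-++ (lmap gs H) (rmap G hs) K) ⟩
      (lmap (lmap gs H) K ++ lmap (rmap G hs) K) ++ rmap (G ⊕ H) ks
        ≡⟨ ++-assoc (lmap (lmap gs H) K) (lmap (rmap G hs) K) (rmap (G ⊕ H) ks) ⟩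
      lmap (lmap gs H) K ++ lmap (rmap G hs) K ++ rmap (G ⊕ H) ks
        ≡⟨ cong₂ _++_ (lmap-lmap gs H K) (cong₂ _++_ (lmap-rmap G hs K) (rmap-rmap G H ks)) ⟩
      lmap gs (H ⊕ K) ++ rmap G (lmap hs K) ++ rmap G (rmap H ks)
        ≡⟨ cong (lmap gs (H ⊕ K) ++_) (rmap-++ G (lmap hs K) (rmap H ks)) ⟨
      lmap gs (H ⊕ K) ++ rmap G (lmap hs K ++ rmap H ks) ∎
      where open ≡-Reasoning

    lmap-lmap : ∀ gs H K → lmap (lmap gs H) K ≡ lmap gs (H ⊕ K)
    lmap-lmap []       H K = refl
    lmap-lmap (g ∷ gs) H K = cong₂ _∷_ (⊕-assoc g H K) (lmap-lmap gs H K)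

    lmap-rmap : ∀ G hs K → lmap (rmap G hs) K ≡ rmap G (lmap hs K)
    lmap-rmap G []       K = refl
    lmap-rmap G (h ∷ hs) K = cong₂ _∷_ (⊕-assoc G h K) (lmap-rmap G hs K)

    rmap-rmap : ∀ G H ks → rmap (G ⊕ H) ks ≡ rmap G (rmap H ks)
    rmap-rmap G H []       = refl
    rmap-rmap G H (k ∷ ks) = cong₂ _∷_ (⊕-assoc G H k) (rmap-rmap G H ks)

  mutual
    ⊕-identityˡ : ∀ G → num 0r ⊕ G ≡ G
    ⊕-identityˡ (mk gl s gr) = mk-cong (rmap-identityˡ gl) (+-identityˡ s) (rmap-identityˡ gr)

    rmap-identityˡ : ∀ gs → rmap (num 0r) gs ≡ gs
    rmap-identityˡ []       = refl
    rmap-identityˡ (g ∷ gs) = cong₂ _∷_ (⊕-identityˡ g) (rmap-identityˡ gs)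

  mutual
    ⊕-identityʳ : ∀ G → G ⊕ num 0r ≡ G
    ⊕-identityʳ (mk gl s gr) =
      mk-cong (trans (++-identityʳ _) (lmap-identityʳ gl)) (+-identityʳ s)
              (trans (++-identityʳ _) (lmap-identityʳ gr))

    lmap-identityʳ : ∀ gs → lmap gs (num 0r) ≡ gs
    lmap-identityʳ []       = refl
    lmap-identityʳ (g ∷ gs) = cong₂ _∷_ (⊕-identityʳ g) (lmap-identityʳ gs)

  mutual
    neg-⊕ : ∀ G H → neg (G ⊕ H) ≡ neg G ⊕ neg H
    neg-⊕ G@(mk gl s gr) H@(mk hl t hr) =
      mk-cong (trans (negs-++ (lmap gr H) (rmap G hr)) (cong₂ _++_ (negs-lmap gr H) (negs-rmap G hr)))
              (sym (⁻¹-∙-comm s t))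
              (trans (negs-++ (lmap gl H) (rmap G hl)) (cong₂ _++_ (negs-lmap gl H) (negs-rmap G hl)))

    negs-lmap : ∀ gs H → negs (lmap gs H) ≡ lmap (negs gs) (neg H)
    negs-lmap []       H = refl
    negs-lmap (g ∷ gs) H = cong₂ _∷_ (neg-⊕ g H) (negs-lmap gs H)

    negs-rmap : ∀ G hs → negs (rmap G hs) ≡ rmap (neg G) (negs hs)
    negs-rmap G []       = refl
    negs-rmap G (h ∷ hs) = cong₂ _∷_ (neg-⊕ G h) (negs-rmap G hs)

  mutual
    num-⊕-comm : ∀ c H → num c ⊕ H ≡ H ⊕ num c
    num-⊕-comm c (mk hl t hr) =
      mk-cong (trans (rmap-num c hl) (sym (++-identityʳ _))) (+-comm c t)
              (trans (rmap-num c hr) (sym (++-identityʳ _)))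

    rmap-num : ∀ c hs → rmap (num c) hs ≡ lmap hs (num c)
    rmap-num c []       = refl
    rmap-num c (h ∷ hs) = cong₂ _∷_ (num-⊕-comm c h) (rmap-num c hs)

  ⊕-num-swap : ∀ A c H → (A ⊕ num c) ⊕ H ≡ (A ⊕ H) ⊕ num c
  ⊕-num-swap A c H = begin
    (A ⊕ num c) ⊕ H   ≡⟨ ⊕-assoc A (num c) H ⟩
    A ⊕ (num c ⊕ H)   ≡⟨ cong (A ⊕_) (num-⊕-comm c H) ⟩
    A ⊕ (H ⊕ num c)   ≡⟨ ⊕-assoc A H (num c) ⟨
    (A ⊕ H) ⊕ num c   ∎
    where open ≡-Reasoning

  -- Normal play

  -- leftWins G: Left, moving first in G, wins when the player unable to move
  -- loses; scores are ignored.
  mutual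
    leftWins : Game → Bool
    leftWins (mk gl _ _) = someRightLoses gl

    rightWins : Game → Bool
    rightWins (mk _ _ gr) = someLeftLoses gr

    someRightLoses : List Game → Bool
    someRightLoses []       = false
    someRightLoses (g ∷ gs) = not (rightWins g) ∨ someRightLoses gs

    someLeftLoses : List Game → Bool
    someLeftLoses []       = false
    someLeftLoses (g ∷ gs) = not (leftWins g) ∨ someLeftLoses gs

  someRightLoses-true : ∀ {gs} → Any (λ g → rightWins g ≡ false) gs → someRightLoses gs ≡ true
  someRightLoses-true (here p) rewrite p = refl
  someRightLoses-true {g ∷ _} (there ps) rewrite someRightLoses-true ps = ∨-comm (not (rightWins g)) true

  someRightLoses-true⁻ : ∀ gs → someRightLoses gs ≡ true → Any (λ g → rightWins g ≡ false) gs
  someRightLoses-true⁻ (g ∷ gs) p with rightWins g in eq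
  ... | false = here eq
  ... | true  = there (someRightLoses-true⁻ gs p)

  someRightLoses-false : ∀ {gs} → All (λ g → rightWins g ≡ true) gs → someRightLoses gs ≡ false
  someRightLoses-false []       = refl
  someRightLoses-false (p ∷ ps) rewrite p = someRightLoses-false ps

  someLeftLoses-true : ∀ {gs} → Any (λ g → leftWins g ≡ false) gs → someLeftLoses gs ≡ true
  someLeftLoses-true (here p) rewrite p = refl
  someLeftLoses-true {g ∷ _} (there ps) rewrite someLeftLoses-true ps = ∨-comm (not (leftWins g)) true

  someLeftLoses-false : ∀ {gs} → All (λ g → leftWins g ≡ true) gs → someLeftLoses gs ≡ false
  someLeftLoses-false []       = refl
  someLeftLoses-false (p ∷ ps) rewrite p = someLeftLoses-false ps

  someLeftLoses-false⁻ : ∀ gs → someLeftLoses gs ≡ false → All (λ g → leftWins g ≡ true) gs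
  someLeftLoses-false⁻ []       _ = []
  someLeftLoses-false⁻ (g ∷ gs) p with leftWins g in eq
  ... | true = eq ∷ someLeftLoses-false⁻ gs p

  someRightLoses-++ : ∀ gs gs′ → someRightLoses (gs ++ gs′) ≡ someRightLoses gs ∨ someRightLoses gs′
  someRightLoses-++ []       gs′ = refl
  someRightLoses-++ (g ∷ gs) gs′ =
    trans (cong (not (rightWins g) ∨_) (someRightLoses-++ gs gs′)) (sym (∨-assoc (not (rightWins g)) _ _))

  someLeftLoses-++ : ∀ gs gs′ → someLeftLoses (gs ++ gs′) ≡ someLeftLoses gs ∨ someLeftLoses gs′
  someLeftLoses-++ []       gs′ = refl
  someLeftLoses-++ (g ∷ gs) gs′ =
    trans (cong (not (leftWins g) ∨_) (someLeftLoses-++ gs gs′)) (sym (∨-assoc (not (leftWins g)) _ _))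

  mutual
    leftWins-neg : ∀ G → leftWins (neg G) ≡ rightWins G
    leftWins-neg (mk _ _ gr) = someRightLoses-negs gr

    rightWins-neg : ∀ G → rightWins (neg G) ≡ leftWins G
    rightWins-neg (mk gl _ _) = someLeftLoses-negs gl

    someRightLoses-negs : ∀ gs → someRightLoses (negs gs) ≡ someLeftLoses gs
    someRightLoses-negs []       = refl
    someRightLoses-negs (g ∷ gs) = cong₂ (λ b c → not b ∨ c) (rightWins-neg g) (someRightLoses-negs gs)

    someLeftLoses-negs : ∀ gs → someLeftLoses (negs gs) ≡ someRightLoses gs
    someLeftLoses-negs []       = refl
    someLeftLoses-negs (g ∷ gs) = cong₂ (λ b c → not b ∨ c) (leftWins-neg g) (someLeftLoses-negs gs)

  mutual
    leftWins-comm : ∀ G H → leftWins (G ⊕ H) ≡ leftWins (H ⊕ G)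
    leftWins-comm G@(mk gl _ _) H@(mk hl _ _) = begin
      someRightLoses (lmap gl H ++ rmap G hl)                 ≡⟨ someRightLoses-++ (lmap gl H) (rmap G hl) ⟩
      someRightLoses (lmap gl H) ∨ someRightLoses (rmap G hl)
        ≡⟨ cong₂ _∨_ (someRightLoses-lmap gl H) (sym (someRightLoses-lmap hl G)) ⟩
      someRightLoses (rmap H gl) ∨ someRightLoses (lmap hl G) ≡⟨ ∨-comm (someRightLoses (rmap H gl)) _ ⟩
      someRightLoses (lmap hl G) ∨ someRightLoses (rmap H gl) ≡⟨ someRightLoses-++ (lmap hl G) (rmap H gl) ⟨
      someRightLoses (lmap hl G ++ rmap H gl)                 ∎
      where open ≡-Reasoning

    rightWins-comm : ∀ G H → rightWins (G ⊕ H) ≡ rightWins (H ⊕ G)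
    rightWins-comm G@(mk _ _ gr) H@(mk _ _ hr) = begin
      someLeftLoses (lmap gr H ++ rmap G hr)                ≡⟨ someLeftLoses-++ (lmap gr H) (rmap G hr) ⟩
      someLeftLoses (lmap gr H) ∨ someLeftLoses (rmap G hr)
        ≡⟨ cong₂ _∨_ (someLeftLoses-lmap gr H) (sym (someLeftLoses-lmap hr G)) ⟩
      someLeftLoses (rmap H gr) ∨ someLeftLoses (lmap hr G) ≡⟨ ∨-comm (someLeftLoses (rmap H gr)) _ ⟩
      someLeftLoses (lmap hr G) ∨ someLeftLoses (rmap H gr) ≡⟨ someLeftLoses-++ (lmap hr G) (rmap H gr) ⟨
      someLeftLoses (lmap hr G ++ rmap H gr)                ∎
      where open ≡-Reasoning

    someRightLoses-lmap : ∀ gs H → someRightLoses (lmap gs H) ≡ someRightLoses (rmap H gs)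
    someRightLoses-lmap []       H = refl
    someRightLoses-lmap (g ∷ gs) H = cong₂ (λ b c → not b ∨ c) (rightWins-comm g H) (someRightLoses-lmap gs H)

    someLeftLoses-lmap : ∀ gs H → someLeftLoses (lmap gs H) ≡ someLeftLoses (rmap H gs)
    someLeftLoses-lmap []       H = refl
    someLeftLoses-lmap (g ∷ gs) H = cong₂ (λ b c → not b ∨ c) (leftWins-comm g H) (someLeftLoses-lmap gs H)

  mutual
    rightLoses-⊕ : ∀ G H → rightWins G ≡ false → rightWins H ≡ false → rightWins (G ⊕ H) ≡ false
    rightLoses-⊕ G@(mk _ _ gr) H@(mk _ _ hr) p q =
      someLeftLoses-false (Allₚ.++⁺ (leftWins-lmap gr H (someLeftLoses-false⁻ gr p) q)
                                   (leftWins-rmap G hr p (someLeftLoses-false⁻ hr q)))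

    leftWins-⊕ˡ : ∀ G H → leftWins G ≡ true → rightWins H ≡ false → leftWins (G ⊕ H) ≡ true
    leftWins-⊕ˡ (mk gl _ _) H@(mk _ _ _) p q =
      someRightLoses-true (Anyₚ.++⁺ˡ (rightLoses-lmap gl H (someRightLoses-true⁻ gl p) q))

    leftWins-⊕ʳ : ∀ G H → rightWins G ≡ false → leftWins H ≡ true → leftWins (G ⊕ H) ≡ true
    leftWins-⊕ʳ G H p q = trans (leftWins-comm G H) (leftWins-⊕ˡ H G q p)

    leftWins-lmap : ∀ gs H → All (λ g → leftWins g ≡ true) gs → rightWins H ≡ false →
                    All (λ g → leftWins g ≡ true) (lmap gs H)
    leftWins-lmap []       H []       q = []
    leftWins-lmap (g ∷ gs) H (p ∷ ps) q = leftWins-⊕ˡ g H p q ∷ leftWins-lmap gs H ps q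

    leftWins-rmap : ∀ G hs → rightWins G ≡ false → All (λ h → leftWins h ≡ true) hs →
                    All (λ h → leftWins h ≡ true) (rmap G hs)
    leftWins-rmap G []       p []       = []
    leftWins-rmap G (h ∷ hs) p (q ∷ qs) = leftWins-⊕ʳ G h p q ∷ leftWins-rmap G hs p qs

    rightLoses-lmap : ∀ gs H → Any (λ g → rightWins g ≡ false) gs → rightWins H ≡ false →
                      Any (λ g → rightWins g ≡ false) (lmap gs H)
    rightLoses-lmap (g ∷ gs) H (here p)  q = here (rightLoses-⊕ g H p q)
    rightLoses-lmap (g ∷ gs) H (there p) q = there (rightLoses-lmap gs H p q)

  leftLoses-⊕ : ∀ G H → leftWins G ≡ false → leftWins H ≡ false → leftWins (G ⊕ H) ≡ false
  leftLoses-⊕ G H p q = begin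
    leftWins (G ⊕ H)          ≡⟨ rightWins-neg (G ⊕ H) ⟨
    rightWins (neg (G ⊕ H))   ≡⟨ cong rightWins (neg-⊕ G H) ⟩
    rightWins (neg G ⊕ neg H)
      ≡⟨ rightLoses-⊕ (neg G) (neg H) (trans (rightWins-neg G) p) (trans (rightWins-neg H) q) ⟩
    false                     ∎
    where open ≡-Reasoning

  SecondPlayerWins : Game → Set
  SecondPlayerWins P = leftWins P ≡ false × rightWins P ≡ false

  secondPlayerWins-neg : ∀ P → SecondPlayerWins P → SecondPlayerWins (neg P)
  secondPlayerWins-neg P (lP , rP) = trans (leftWins-neg P) rP , trans (rightWins-neg P) lP

  leftWins-absorb : ∀ P → SecondPlayerWins P → ∀ X → leftWins (P ⊕ X) ≡ leftWins X
  leftWins-absorb P (lP , rP) X with leftWins X in eq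
  ... | true  = leftWins-⊕ʳ P X rP eq
  ... | false = leftLoses-⊕ P X lP eq

  rightWins-absorb : ∀ P → SecondPlayerWins P → ∀ X → rightWins (P ⊕ X) ≡ rightWins X
  rightWins-absorb P sP X = begin
    rightWins (P ⊕ X)        ≡⟨ leftWins-neg (P ⊕ X) ⟨
    leftWins (neg (P ⊕ X))   ≡⟨ cong leftWins (neg-⊕ P X) ⟩
    leftWins (neg P ⊕ neg X) ≡⟨ leftWins-absorb (neg P) (secondPlayerWins-neg P sP) (neg X) ⟩
    leftWins (neg X)         ≡⟨ leftWins-neg X ⟩
    rightWins X              ∎
    where open ≡-Reasoning

  rightWins-⊕-num : ∀ G c → rightWins (G ⊕ num c) ≡ rightWins G
  rightWins-⊕-num G c = trans (rightWins-comm G (num c)) (rightWins-absorb (num c) (refl , refl) G)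

  leftWins-⊕-num : ∀ G c → leftWins (G ⊕ num c) ≡ leftWins G
  leftWins-⊕-num G c = trans (leftWins-comm G (num c)) (leftWins-absorb (num c) (refl , refl) G)

  leftOptions rightOptions : Game → List Game
  leftOptions (mk gl _ _) = gl
  rightOptions (mk _ _ gr) = gr

  ∈-lmap : ∀ {g gs} H → g ∈ gs → g ⊕ H ∈ lmap gs H
  ∈-lmap H (here refl) = here refl
  ∈-lmap H (there g∈)  = there (∈-lmap H g∈)

  ∈-rmap : ∀ G {h hs} → h ∈ hs → G ⊕ h ∈ rmap G hs
  ∈-rmap G (here refl) = here refl
  ∈-rmap G (there h∈)  = there (∈-rmap G h∈)

  ∈-negs : ∀ {g gs} → g ∈ gs → neg g ∈ negs gs
  ∈-negs (here refl) = here refl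
  ∈-negs (there g∈)  = there (∈-negs g∈)

  All-lmap : ∀ {P : Game → Set} gs H → All (λ g → P (g ⊕ H)) gs → All P (lmap gs H)
  All-lmap []       H []       = []
  All-lmap (g ∷ gs) H (p ∷ ps) = p ∷ All-lmap gs H ps

  All-rmap-negs : ∀ {P : Game → Set} G hs → All (λ h → P (G ⊕ neg h)) hs → All P (rmap G (negs hs))
  All-rmap-negs G []       []       = []
  All-rmap-negs G (h ∷ hs) (p ∷ ps) = p ∷ All-rmap-negs G hs ps

  ∈-rightOptions-⊕ˡ : ∀ {g} G H → g ∈ rightOptions G → g ⊕ H ∈ rightOptions (G ⊕ H)
  ∈-rightOptions-⊕ˡ (mk _ _ _) H@(mk _ _ _) g∈ = ∈-++⁺ˡ (∈-lmap H g∈)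

  ∈-rightOptions-⊕ʳ : ∀ {h} G H → h ∈ rightOptions H → G ⊕ h ∈ rightOptions (G ⊕ H)
  ∈-rightOptions-⊕ʳ G@(mk _ _ gr) H@(mk _ _ _) h∈ = ∈-++⁺ʳ (lmap gr H) (∈-rmap G h∈)

  rightWins-intro : ∀ G {g} → g ∈ rightOptions G → leftWins g ≡ false → rightWins G ≡ true
  rightWins-intro (mk _ _ _) g∈ p = someLeftLoses-true (lose g∈ p)

  -- Mirror strategy: Right answers a Left move in G (resp. −G) by the copy of
  -- it in −G (resp. G), reaching g + (−g) for an option g of G.
  leftLoses-mirror-step : ∀ G →
    All (λ g → leftWins (g ⊕ neg g) ≡ false) (leftOptions G) →
    All (λ g → leftWins (g ⊕ neg g) ≡ false) (rightOptions G) →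
    leftWins (G ⊕ neg G) ≡ false
  leftLoses-mirror-step G@(mk gl _ gr) ihl ihr =
    someRightLoses-false (Allₚ.++⁺
      (All-lmap gl (neg G) (All.tabulate λ {g} g∈ →
        rightWins-intro (g ⊕ neg G) (∈-rightOptions-⊕ʳ g (neg G) (∈-negs g∈)) (All.lookup ihl g∈)))
      (All-rmap-negs G gr (All.tabulate λ {g} g∈ →
        rightWins-intro (G ⊕ neg g) (∈-rightOptions-⊕ˡ G (neg g) g∈) (All.lookup ihr g∈))))

  mutual
    leftLoses-mirror : ∀ G → leftWins (G ⊕ neg G) ≡ false
    leftLoses-mirror G@(mk gl _ gr) =
      leftLoses-mirror-step G (leftLoses-mirror-all gl) (leftLoses-mirror-all gr)

    leftLoses-mirror-all : ∀ gs → All (λ g → leftWins (g ⊕ neg g) ≡ false) gs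
    leftLoses-mirror-all []       = []
    leftLoses-mirror-all (g ∷ gs) = leftLoses-mirror g ∷ leftLoses-mirror-all gs

  secondPlayerWins-mirror : ∀ G → SecondPlayerWins (G ⊕ neg G)
  secondPlayerWins-mirror G = leftLoses-mirror G , (begin
    rightWins (G ⊕ neg G)             ≡⟨ leftWins-neg (G ⊕ neg G) ⟨
    leftWins (neg (G ⊕ neg G))        ≡⟨ cong leftWins (neg-⊕ G (neg G)) ⟩
    leftWins (neg G ⊕ neg (neg G))    ≡⟨ leftLoses-mirror (neg G) ⟩
    false                             ∎)
    where open ≡-Reasoning

  secondPlayerWins-comm : ∀ G H → SecondPlayerWins (G ⊕ H) → SecondPlayerWins (H ⊕ G)
  secondPlayerWins-comm G H (l , r) = trans (leftWins-comm H G) l , trans (rightWins-comm H G) r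

  infix 4 _≃_
  record _≃_ (G H : Game) : Set where
    field
      leftWins-≡  : leftWins G ≡ leftWins H
      rightWins-≡ : rightWins G ≡ rightWins H
  open _≃_

  ≃-isEquivalence : IsEquivalence _≃_
  ≃-isEquivalence = record
    { refl  = record { leftWins-≡ = refl ; rightWins-≡ = refl }
    ; sym   = λ e → record { leftWins-≡ = sym (leftWins-≡ e) ; rightWins-≡ = sym (rightWins-≡ e) }
    ; trans = λ e f → record { leftWins-≡  = trans (leftWins-≡ e) (leftWins-≡ f)
                             ; rightWins-≡ = trans (rightWins-≡ e) (rightWins-≡ f) }
    }

  ≃-setoid : Setoid _ _
  ≃-setoid = record { Carrier = Game ; _≈_ = _≃_ ; isEquivalence = ≃-isEquivalence }

  ⊕-comm-≃ : ∀ G H → G ⊕ H ≃ H ⊕ G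
  ⊕-comm-≃ G H = record { leftWins-≡ = leftWins-comm G H ; rightWins-≡ = rightWins-comm G H }

  absorb-≃ : ∀ P → SecondPlayerWins P → ∀ X → P ⊕ X ≃ X
  absorb-≃ P sP X = record { leftWins-≡ = leftWins-absorb P sP X ; rightWins-≡ = rightWins-absorb P sP X }

  mutual
    finalL-⊕-num : ∀ G c → finalL (G ⊕ num c) ≡ finalL G + c
    finalL-⊕-num (mk []       _ _) c = refl
    finalL-⊕-num (mk (g ∷ gs) _ _) c = maxR-⊕-num g gs c

    finalR-⊕-num : ∀ G c → finalR (G ⊕ num c) ≡ finalR G + c
    finalR-⊕-num (mk _ _ [])       c = refl
    finalR-⊕-num (mk _ _ (g ∷ gs)) c = minL-⊕-num g gs c

    maxR-⊕-num : ∀ g gs c → maxR (g ⊕ num c) (lmap gs (num c) ++ []) ≡ maxR g gs + c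
    maxR-⊕-num g []        c = finalR-⊕-num g c
    maxR-⊕-num g (g′ ∷ gs) c =
      trans (cong₂ max (finalR-⊕-num g c) (maxR-⊕-num g′ gs c)) (sym (mono-<-distrib-max (+-mono-< c) _ _))

    minL-⊕-num : ∀ g gs c → minL (g ⊕ num c) (lmap gs (num c) ++ []) ≡ minL g gs + c
    minL-⊕-num g []        c = finalL-⊕-num g c
    minL-⊕-num g (g′ ∷ gs) c =
      trans (cong₂ min (finalL-⊕-num g c) (minL-⊕-num g′ gs c)) (sym (mono-<-distrib-min (+-mono-< c) _ _))

  ScoresIn : Outcome → ℝ → ℝ → Set
  ScoresIn 𝓛 a b = (0r < a × 0r < b) ⊎ (0r < a × b ≡ 0r) ⊎ (a ≡ 0r × 0r < b)
  ScoresIn 𝓡 a b = (a < 0r × b < 0r) ⊎ (a < 0r × b ≡ 0r) ⊎ (a ≡ 0r × b < 0r)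
  ScoresIn 𝓝 a b = 0r < a × b < 0r
  ScoresIn 𝓟 a b = a < 0r × 0r < b
  ScoresIn 𝓣 a b = a ≡ 0r × b ≡ 0r

  In≡ScoresIn : ∀ o G → In o G ≡ ScoresIn o (finalL G) (finalR G)
  In≡ScoresIn 𝓛 G = refl
  In≡ScoresIn 𝓡 G = refl
  In≡ScoresIn 𝓝 G = refl
  In≡ScoresIn 𝓟 G = refl
  In≡ScoresIn 𝓣 G = refl

  -- Tame games

  module _ {x : ℝ} where

    ShiftedTame : ℝ → Game → Set
    ShiftedTame c g = Σ Game λ A → Tame x A × g ≡ A ⊕ num c

    Tame-zero : Tame x (num 0r)
    Tame-zero = tame [] []

    mutual
      Tame-⊕ : ∀ {G H} → Tame x G → Tame x H → Tame x (G ⊕ H)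
      Tame-⊕ {G@(mk gl _ gr)} {H@(mk hl _ hr)} tG@(tame pl pr) tH@(tame ql qr) =
        subst (λ s → Tame x (mk (lmap gl H ++ rmap G hl) s (lmap gr H ++ rmap G hr))) (sym (+-identityʳ 0r))
          (tame (Allₚ.++⁺ (shiftedTame-lmap gl tH pl) (shiftedTame-rmap hl tG ql))
                (Allₚ.++⁺ (shiftedTame-lmap gr tH pr) (shiftedTame-rmap hr tG qr)))

      shiftedTame-lmap : ∀ {c} gs {H} → Tame x H → All (ShiftedTame c) gs → All (ShiftedTame c) (lmap gs H)
      shiftedTame-lmap []       tH [] = []
      shiftedTame-lmap {c} (_ ∷ gs) {H} tH ((A , tA , refl) ∷ ps) =
        (A ⊕ H , Tame-⊕ tA tH , ⊕-num-swap A c H) ∷ shiftedTame-lmap gs tH ps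

      shiftedTame-rmap : ∀ {c} hs {G} → Tame x G → All (ShiftedTame c) hs → All (ShiftedTame c) (rmap G hs)
      shiftedTame-rmap []       tG [] = []
      shiftedTame-rmap {c} (_ ∷ hs) {G} tG ((A , tA , refl) ∷ ps) =
        (G ⊕ A , Tame-⊕ tG tA , sym (⊕-assoc G A (num c))) ∷ shiftedTame-rmap hs tG ps

    mutual
      Tame-neg : ∀ {G} → Tame x G → Tame x (neg G)
      Tame-neg {mk gl _ gr} (tame pl pr) =
        subst (λ s → Tame x (mk (negs gr) s (negs gl))) (sym ε⁻¹≈ε)
          (tame (shiftedTame-negs (⁻¹-involutive x) gr pr) (shiftedTame-negs refl gl pl))

      shiftedTame-negs : ∀ {c d} → - c ≡ d → ∀ gs → All (ShiftedTame c) gs → All (ShiftedTame d) (negs gs)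
      shiftedTame-negs -c≡d []       [] = []
      shiftedTame-negs {c} -c≡d (_ ∷ gs) ((B , tB , refl) ∷ ps) =
        (neg B , Tame-neg tB , trans (neg-⊕ B (num c)) (cong (λ v → neg B ⊕ num v) -c≡d))
          ∷ shiftedTame-negs -c≡d gs ps

    module _ (0<x : 0r < x) where

      payoffL payoffR : Bool → ℝ
      payoffL b = if b then x else 0r
      payoffR b = if b then - x else 0r

      payoffR-+x : ∀ b → payoffR b + x ≡ payoffL (not b)
      payoffR-+x true  = -‿inverseˡ x
      payoffR-+x false = +-identityˡ x

      payoffL-+-x : ∀ b → payoffL b + - x ≡ payoffR (not b)
      payoffL-+-x true  = -‿inverseʳ x
      payoffL-+-x false = +-identityˡ (- x)

      max-payoffL : ∀ a b → max (payoffL a) (payoffL b) ≡ payoffL (a ∨ b)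
      max-payoffL true  true  = max-≡ʳ (inj₂ refl)
      max-payoffL true  false = max-≡ˡ (inj₁ 0<x)
      max-payoffL false true  = max-≡ʳ (inj₁ 0<x)
      max-payoffL false false = max-≡ʳ (inj₂ refl)

      min-payoffR : ∀ a b → min (payoffR a) (payoffR b) ≡ payoffR (a ∨ b)
      min-payoffR true  true  = min-≡ˡ (inj₂ refl)
      min-payoffR true  false = min-≡ˡ (inj₁ (neg-<0 0<x))
      min-payoffR false true  = min-≡ʳ (inj₁ (neg-<0 0<x))
      min-payoffR false false = min-≡ˡ (inj₂ refl)

      mutual
        finalL-tame : ∀ {G} → Tame x G → finalL G ≡ payoffL (leftWins G)
        finalL-tame {mk []       _ _} (tame _ _)  = refl
        finalL-tame {mk (g ∷ gs) _ _} (tame pl _) = maxR-leftOptions g gs pl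

        finalR-tame : ∀ {G} → Tame x G → finalR G ≡ payoffR (rightWins G)
        finalR-tame {mk _ _ []}       (tame _ _)  = refl
        finalR-tame {mk _ _ (g ∷ gs)} (tame _ pr) = minL-rightOptions g gs pr

        maxR-leftOptions : ∀ g gs → All (ShiftedTame x) (g ∷ gs) → maxR g gs ≡ payoffL (someRightLoses (g ∷ gs))
        maxR-leftOptions g []        (p ∷ [])  =
          trans (finalR-leftOption p) (cong payoffL (sym (∨-identityʳ _)))
        maxR-leftOptions g (g′ ∷ gs) (p ∷ ps) =
          trans (cong₂ max (finalR-leftOption p) (maxR-leftOptions g′ gs ps)) (max-payoffL _ _)

        minL-rightOptions : ∀ g gs → All (ShiftedTame (- x)) (g ∷ gs) → minL g gs ≡ payoffR (someLeftLoses (g ∷ gs))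
        minL-rightOptions g []        (p ∷ [])  =
          trans (finalL-rightOption p) (cong payoffR (sym (∨-identityʳ _)))
        minL-rightOptions g (g′ ∷ gs) (p ∷ ps) =
          trans (cong₂ min (finalL-rightOption p) (minL-rightOptions g′ gs ps)) (min-payoffR _ _)

        finalR-leftOption : ∀ {g} → ShiftedTame x g → finalR g ≡ payoffL (not (rightWins g))
        finalR-leftOption (A , tA , refl) = begin
          finalR (A ⊕ num x)                    ≡⟨ finalR-⊕-num A x ⟩
          finalR A + x                          ≡⟨ cong (_+ x) (finalR-tame tA) ⟩
          payoffR (rightWins A) + x             ≡⟨ payoffR-+x (rightWins A) ⟩
          payoffL (not (rightWins A))           ≡⟨ cong (payoffL ∘ not) (rightWins-⊕-num A x) ⟨
          payoffL (not (rightWins (A ⊕ num x))) ∎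
          where open ≡-Reasoning

        finalL-rightOption : ∀ {g} → ShiftedTame (- x) g → finalL g ≡ payoffR (not (leftWins g))
        finalL-rightOption (B , tB , refl) = begin
          finalL (B ⊕ num (- x))                   ≡⟨ finalL-⊕-num B (- x) ⟩
          finalL B + - x                           ≡⟨ cong (_+ - x) (finalL-tame tB) ⟩
          payoffL (leftWins B) + - x               ≡⟨ payoffL-+-x (leftWins B) ⟩
          payoffR (not (leftWins B))               ≡⟨ cong (payoffR ∘ not) (leftWins-⊕-num B (- x)) ⟨
          payoffR (not (leftWins (B ⊕ num (- x)))) ∎
          where open ≡-Reasoning

      In-tame : ∀ {G} → Tame x G → ∀ o → In o G ≡ ScoresIn o (payoffL (leftWins G)) (payoffR (rightWins G))
      In-tame {G} tG o = trans (In≡ScoresIn o G) (cong₂ (ScoresIn o) (finalL-tame tG) (finalR-tame tG))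

      outcomeOf : Bool → Bool → Outcome
      outcomeOf true  false = 𝓛
      outcomeOf false true  = 𝓡
      outcomeOf true  true  = 𝓝
      outcomeOf false false = 𝓣

      payoffs-in-outcomeOf : ∀ b c → ScoresIn (outcomeOf b c) (payoffL b) (payoffR c)
      payoffs-in-outcomeOf true  false = inj₂ (inj₁ (0<x , refl))
      payoffs-in-outcomeOf false true  = inj₂ (inj₂ (refl , neg-<0 0<x))
      payoffs-in-outcomeOf true  true  = 0<x , neg-<0 0<x
      payoffs-in-outcomeOf false false = refl , refl

      payoffL-pos : ∀ b → 0r < payoffL b → b ≡ true
      payoffL-pos true  _   = refl
      payoffL-pos false 0<0 = ⊥-elim (<-irrefl refl 0<0)

      payoffL-zero : ∀ b → payoffL b ≡ 0r → b ≡ false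
      payoffL-zero true  x≡0 = ⊥-elim (<-irrefl (sym x≡0) 0<x)
      payoffL-zero false _   = refl

      payoffL-nonneg : ∀ b → ¬ payoffL b < 0r
      payoffL-nonneg true  x<0 = <-asym x<0 0<x
      payoffL-nonneg false 0<0 = <-irrefl refl 0<0

      payoffR-neg : ∀ c → payoffR c < 0r → c ≡ true
      payoffR-neg true  _   = refl
      payoffR-neg false 0<0 = ⊥-elim (<-irrefl refl 0<0)

      payoffR-zero : ∀ c → payoffR c ≡ 0r → c ≡ false
      payoffR-zero true  -x≡0 = ⊥-elim (<-irrefl -x≡0 (neg-<0 0<x))
      payoffR-zero false _    = refl

      payoffR-nonpos : ∀ c → ¬ 0r < payoffR c
      payoffR-nonpos true  0<-x = <-asym 0<-x (neg-<0 0<x)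
      payoffR-nonpos false 0<0  = <-irrefl refl 0<0

      payoffs-determined : ∀ b c b′ c′ → ScoresIn (outcomeOf b c) (payoffL b′) (payoffR c′) → b′ ≡ b × c′ ≡ c
      payoffs-determined true  false b′ c′ (inj₁ (_ , 0<r))          = ⊥-elim (payoffR-nonpos c′ 0<r)
      payoffs-determined true  false b′ c′ (inj₂ (inj₁ (0<l , r≡0))) = payoffL-pos b′ 0<l , payoffR-zero c′ r≡0
      payoffs-determined true  false b′ c′ (inj₂ (inj₂ (_ , 0<r)))   = ⊥-elim (payoffR-nonpos c′ 0<r)
      payoffs-determined false true  b′ c′ (inj₁ (l<0 , _))          = ⊥-elim (payoffL-nonneg b′ l<0)
      payoffs-determined false true  b′ c′ (inj₂ (inj₁ (l<0 , _)))   = ⊥-elim (payoffL-nonneg b′ l<0)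
      payoffs-determined false true  b′ c′ (inj₂ (inj₂ (l≡0 , r<0))) = payoffL-zero b′ l≡0 , payoffR-neg c′ r<0
      payoffs-determined true  true  b′ c′ (0<l , r<0)               = payoffL-pos b′ 0<l , payoffR-neg c′ r<0
      payoffs-determined false false b′ c′ (l≡0 , r≡0)               = payoffL-zero b′ l≡0 , payoffR-zero c′ r≡0

      ≈⇒≃ : ∀ {A B} → Tame x A → Tame x B → A ≈ B → A ≃ B
      ≈⇒≃ {A} {B} tA tB A≈B = record { leftWins-≡ = sym (proj₁ same) ; rightWins-≡ = sym (proj₂ same) }
        where
          o = outcomeOf (leftWins A) (rightWins A)
          A∈o : In o A
          A∈o = subst id (sym (In-tame tA o)) (payoffs-in-outcomeOf (leftWins A) (rightWins A))
          same = payoffs-determined (leftWins A) (rightWins A) (leftWins B) (rightWins B)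
                   (subst id (In-tame tB o) (Equivalence.to (A≈B o) A∈o))

      ≃⇒≈ : ∀ {A B} → Tame x A → Tame x B → A ≃ B → A ≈ B
      ≃⇒≈ {A} {B} tA tB A≃B o = subst (In o A ⇔_) In-A≡In-B ⇔.refl
        where
          In-A≡In-B : In o A ≡ In o B
          In-A≡In-B = trans (In-tame tA o)
            (trans (cong₂ (λ b c → ScoresIn o (payoffL b) (payoffR c)) (leftWins-≡ A≃B) (rightWins-≡ A≃B))
                   (sym (In-tame tB o)))

      -- Tame_x modulo =_x

      infix 4 _∼_
      _∼_ : Game → Game → Set
      G ∼ H = ∀ X → Tame x X → G ⊕ X ≃ H ⊕ X

      =ₓ⇒∼ : ∀ {G H} → Tame x G → Tame x H → G =[ x ] H → G ∼ H
      =ₓ⇒∼ tG tH G=H X tX = ≈⇒≃ (Tame-⊕ tG tX) (Tame-⊕ tH tX) (G=H X tX)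

      ∼⇒=ₓ : ∀ {G H} → Tame x G → Tame x H → G ∼ H → G =[ x ] H
      ∼⇒=ₓ tG tH G∼H X tX = ≃⇒≈ (Tame-⊕ tG tX) (Tame-⊕ tH tX) (G∼H X tX)

      ∼-⊕-cong : ∀ {G G′ H H′} → Tame x G′ → Tame x H → G ∼ G′ → H ∼ H′ → G ⊕ H ∼ G′ ⊕ H′
      ∼-⊕-cong {G} {G′} {H} {H′} tG′ tH G∼G′ H∼H′ X tX = begin
        (G ⊕ H) ⊕ X    ≡⟨ ⊕-assoc G H X ⟩
        G ⊕ (H ⊕ X)    ≈⟨ G∼G′ (H ⊕ X) (Tame-⊕ tH tX) ⟩
        G′ ⊕ (H ⊕ X)   ≈⟨ ⊕-comm-≃ G′ (H ⊕ X) ⟩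
        (H ⊕ X) ⊕ G′   ≡⟨ ⊕-assoc H X G′ ⟩
        H ⊕ (X ⊕ G′)   ≈⟨ H∼H′ (X ⊕ G′) (Tame-⊕ tX tG′) ⟩
        H′ ⊕ (X ⊕ G′)  ≡⟨ ⊕-assoc H′ X G′ ⟨
        (H′ ⊕ X) ⊕ G′  ≈⟨ ⊕-comm-≃ (H′ ⊕ X) G′ ⟩
        G′ ⊕ (H′ ⊕ X)  ≡⟨ ⊕-assoc G′ H′ X ⟨
        (G′ ⊕ H′) ⊕ X  ∎
        where open SetoidReasoning ≃-setoid

      =ₓ-⊕-cong : ∀ {G G′ H H′} → Tame x G → Tame x G′ → Tame x H → Tame x H′ →
                  G =[ x ] G′ → H =[ x ] H′ → (G ⊕ H) =[ x ] (G′ ⊕ H′)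
      =ₓ-⊕-cong tG tG′ tH tH′ G=G′ H=H′ =
        ∼⇒=ₓ (Tame-⊕ tG tH) (Tame-⊕ tG′ tH′)
          (∼-⊕-cong tG′ tH (=ₓ⇒∼ tG tG′ G=G′) (=ₓ⇒∼ tH tH′ H=H′))

      ≡⇒=ₓ : ∀ {G H} → G ≡ H → G =[ x ] H
      ≡⇒=ₓ refl X tX o = ⇔.refl

      secondPlayerWins-=ₓ-zero : ∀ {P} → Tame x P → SecondPlayerWins P → P =[ x ] num 0r
      secondPlayerWins-=ₓ-zero {P} tP sP = ∼⇒=ₓ tP Tame-zero λ X tX → begin
        P ⊕ X        ≈⟨ absorb-≃ P sP X ⟩
        X            ≡⟨ ⊕-identityˡ X ⟨
        num 0r ⊕ X   ∎
        where open SetoidReasoning ≃-setoid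

      infix 4 _≈ₓ_
      _≈ₓ_ : TameGame x → TameGame x → Set
      a ≈ₓ b = proj₁ a =[ x ] proj₁ b

      infixl 6 _∙_
      _∙_ : TameGame x → TameGame x → TameGame x
      a ∙ b = proj₁ a ⊕ proj₁ b , Tame-⊕ (proj₂ a) (proj₂ b)

      ε : TameGame x
      ε = num 0r , Tame-zero

      _⁻¹ : TameGame x → TameGame x
      a ⁻¹ = neg (proj₁ a) , Tame-neg (proj₂ a)

      ≈ₓ-isEquivalence : IsEquivalence _≈ₓ_
      ≈ₓ-isEquivalence = record
        { refl  = λ X tX o → ⇔.refl
        ; sym   = λ a=b X tX o → ⇔.sym (a=b X tX o)
        ; trans = λ a=b b=c X tX o → ⇔.trans (a=b X tX o) (b=c X tX o)
        }

      ∙-isMonoid : IsMonoid _≈ₓ_ _∙_ ε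
      ∙-isMonoid = record
        { isSemigroup = record
          { isMagma = record
            { isEquivalence = ≈ₓ-isEquivalence
            ; ∙-cong = λ {a} {b} {c} {d} → =ₓ-⊕-cong (proj₂ a) (proj₂ b) (proj₂ c) (proj₂ d)
            }
          ; assoc = λ a b c → ≡⇒=ₓ (⊕-assoc (proj₁ a) (proj₁ b) (proj₁ c))
          }
        ; identity = (λ a → ≡⇒=ₓ (⊕-identityˡ (proj₁ a))) , (λ a → ≡⇒=ₓ (⊕-identityʳ (proj₁ a)))
        }

      ⁻¹-inverseˡ : ∀ a → a ⁻¹ ∙ a ≈ₓ ε
      ⁻¹-inverseˡ (G , tG) = secondPlayerWins-=ₓ-zero (Tame-⊕ (Tame-neg tG) tG)
                               (secondPlayerWins-comm G (neg G) (secondPlayerWins-mirror G))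

      ⁻¹-inverseʳ : ∀ a → a ∙ a ⁻¹ ≈ₓ ε
      ⁻¹-inverseʳ (G , tG) = secondPlayerWins-=ₓ-zero (Tame-⊕ tG (Tame-neg tG)) (secondPlayerWins-mirror G)

      ⁻¹-cong : ∀ {a b} → a ≈ₓ b → a ⁻¹ ≈ₓ b ⁻¹
      ⁻¹-cong {a} {b} a≈b = begin
        a ⁻¹                ≈⟨ identityʳ (a ⁻¹) ⟨
        a ⁻¹ ∙ ε            ≈⟨ ∙-congˡ {a ⁻¹} {b ∙ b ⁻¹} {ε} (⁻¹-inverseʳ b) ⟨
        a ⁻¹ ∙ (b ∙ b ⁻¹)   ≈⟨ assoc (a ⁻¹) b (b ⁻¹) ⟨
        a ⁻¹ ∙ b ∙ b ⁻¹     ≈⟨ ∙-congʳ {b ⁻¹} {a ⁻¹ ∙ a} {a ⁻¹ ∙ b} (∙-congˡ {a ⁻¹} {a} {b} a≈b) ⟨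
        a ⁻¹ ∙ a ∙ b ⁻¹     ≈⟨ ∙-congʳ {b ⁻¹} {a ⁻¹ ∙ a} {ε} (⁻¹-inverseˡ a) ⟩
        ε ∙ b ⁻¹            ≈⟨ identityˡ (b ⁻¹) ⟩
        b ⁻¹                ∎
        where open IsMonoid ∙-isMonoid
              open SetoidReasoning setoid

      tameIsGroup : TameIsGroup x
      tameIsGroup = (λ {G} {H} → Tame-⊕ {G} {H}) , ε , _⁻¹ , record
        { isMonoid = ∙-isMonoid
        ; inverse  = ⁻¹-inverseˡ , ⁻¹-inverseʳ
        ; ⁻¹-cong  = λ {a} {b} → ⁻¹-cong {a} {b}
        }

mainTheorem2 : (R : RealNumbers) → TameGroupStatement R
mainTheorem2 R x 0<x = tameIsGroup R 0<x
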